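{- For every integer $n\ge 1$, $\overrightarrow{\beta}(K_n,1)\ge n-3$, where $K_n$ is the complete graph on $n$ vertices.
   Context: Firefighting on oriented graphs: an orientation $\overrightarrow{G}$ of a finite simple graph $G$ replaces each edge $uv$ by exactly one of the arcs $\overrightarrow{uv}$, $\overrightarrow{vu}$. Let $f\ge 1$ be an integer. A fire breaks out at a vertex $v$ at time $1$ ($v$ burns). At the end of each time unit, the firefighters permanently protect up to $f$ vertices that are neither burning nor already protected. At the next time unit, every vertex that is neither burning nor protected and is an out-neighbour of a burning vertex starts to burn. The process ends when no new vertex can burn. $\beta(\overrightarrow{G},f)$ is the maximum, over all starting vertices $v$, of the minimum, over all protection strategies, of the number of vertices that burn. $\overrightarrow{\beta}(G,f)$ is the minimum of $\beta(\overrightarrow{G},f)$ over all orientations $\overrightarrow{G}$ of $G$. -}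

module Defs where

open import Data.Nat using (ℕ; zero; suc; _≤_; _∸_)
open import Data.Bool using (Bool; true; false; not; _∧_; _∨_; if_then_else_)
open import Data.Fin using (Fin; zero; suc)
open import Data.Fin.Subset using (Subset; ⁅_⁆; ⊥; _∪_; ∣_∣; _∈_; _∉_)
open import Data.Vec using (Vec; tabulate; lookup)
open import Data.List using (List; length; foldr)
open import Data.List.Relation.Unary.All using (All)
open import Data.Maybe using (Maybe)
open import Data.Product using (_×_; ∃)
open import Relation.Binary.PropositionalEquality using (_≡_; _≢_)

record SimpleGraph (n : ℕ) : Set where
  field
    adj   : Fin n → Fin n → Bool
    irrefl : ∀ u → adj u u ≡ false
    sym    : ∀ u v → adj u v ≡ adj v u
open SimpleGraph public

K : (n : ℕ) → SimpleGraph n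
K n = record { adj = λ u v → not (u ≟b v) ; irrefl = λ u → irr u ; sym = λ u v → sy u v }
  where
  _≟b_ : ∀ {m} → Fin m → Fin m → Bool
  zero ≟b zero = true
  zero ≟b suc _ = false
  suc _ ≟b zero = false
  suc a ≟b suc b = a ≟b b
  irr : ∀ {m} (u : Fin m) → not (u ≟b u) ≡ false
  irr zero = _≡_.refl
  irr (suc u) = irr u
  sy : ∀ {m} (u v : Fin m) → not (u ≟b v) ≡ not (v ≟b u)
  sy zero zero = _≡_.refl
  sy zero (suc v) = _≡_.refl
  sy (suc u) zero = _≡_.refl
  sy (suc u) (suc v) = sy u v

IsOrientation : ∀ {n} → SimpleGraph n → (Fin n → Fin n → Bool) → Set
IsOrientation {n} G D =
  (∀ (u v : Fin n) → D u v ≡ true → adj G u v ≡ true) ×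
  (∀ (u v : Fin n) → adj G u v ≡ true → D u v ≡ not (D v u))

anyFin : ∀ {n} → (Fin n → Bool) → Bool
anyFin {zero} p = false
anyFin {suc n} p = p zero ∨ anyFin (λ i → p (suc i))

addAll : ∀ {n} → List (Fin n) → Subset n → Subset n
addAll xs S = foldr (λ x T → ⁅ x ⁆ ∪ T) S xs

-- A protection strategy: at the end of time unit k+1 (index k) the
-- firefighters protect the vertices in σ k.
Strategy : ℕ → Set
Strategy n = ℕ → List (Fin n)

-- The state of the process (burning set, protected set) indexed by k,
-- where index k corresponds to time unit k+1.
-- state k = (B_k , P_k): B_k burns at time k+1, P_k protected before
-- the protection step at the end of time k+1.
state : ∀ {n} → (Fin n → Fin n → Bool) → Fin n → Strategy n → ℕ → Subset n × Subset n
state D v σ zero = ⁅ v ⁆ Data.Product., ⊥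
state {n} D v σ (suc k) with state D v σ k
... | B Data.Product., P = B ∪ new Data.Product., P'
  where
  P' : Subset n
  P' = addAll (σ k) P
  new : Subset n
  new = tabulate (λ w → not (lookup B w) ∧ not (lookup P' w)
                         ∧ anyFin (λ u → lookup B u ∧ D u w))

burning : ∀ {n} → (Fin n → Fin n → Bool) → Fin n → Strategy n → ℕ → Subset n
burning D v σ k = Data.Product.proj₁ (state D v σ k)

protected : ∀ {n} → (Fin n → Fin n → Bool) → Fin n → Strategy n → ℕ → Subset n
protected D v σ k = Data.Product.proj₂ (state D v σ k)

ValidStrategy : ∀ {n} → (Fin n → Fin n → Bool) → Fin n → ℕ → Strategy n → Set
ValidStrategy D v f σ =
  ∀ k → (length (σ k) ≤ f) ×
        All (λ x → (x ∉ burning D v σ k) × (x ∉ protected D v σ k)) (σ k)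

AlwaysBurnsAtLeast : ∀ {n} → (Fin n → Fin n → Bool) → ℕ → Fin n → ℕ → Set
AlwaysBurnsAtLeast D f v m =
  ∀ σ → ValidStrategy D v f σ →
  ∀ k → burning D v σ (suc k) ≡ burning D v σ k →
  m ≤ ∣ burning D v σ k ∣

βOr≥ : ∀ {n} → (Fin n → Fin n → Bool) → ℕ → ℕ → Set
βOr≥ {n} D f m = ∃ λ (v : Fin n) → AlwaysBurnsAtLeast D f v m

βArrow≥ : ∀ {n} → SimpleGraph n → ℕ → ℕ → Set
βArrow≥ {n} G f m = ∀ (D : Fin n → Fin n → Bool) → IsOrientation G D → βOr≥ D f m

-- Proposition: for every n ≥ 1 and every orientation D of the complete
-- graph K_n, one firefighter cannot keep the fire to fewer than n - 3
-- vertices, provided the fire starts at a vertex v of maximum out-degree.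
--
-- An orientation of K_n is a tournament.  Call a vertex an escapee if it
-- is neither burning nor protected at time 3.  An escapee w beats every
-- vertex burning at time 2 (otherwise the fire would reach w), so its
-- out-degree is at least the number of vertices burning at time 2.  That
-- number is at least d⁺(v): those are v and all out-neighbours of v except
-- the one protected at time 1.  If w₁ beats another escapee w₂, then w₂ is
-- a further out-neighbour of w₁ and d⁺(w₁) > d⁺(v), contradicting the
-- choice of v.  Hence there is at most one escapee, and at most two
-- protected vertices by time 3, so at most three vertices outside the set
-- burning at time 3.  That set is contained in the final burnt set.
module Submission where

open import Defs
open import Data.Nat using (ℕ; _≤_; _∸_)
open import Data.Nat using (zero; suc; _+_; _*_; _<_; z≤n; s≤s; _≤?_)
open import Data.Nat.Properties
  using (≤-refl; ≤-trans; <-irrefl; <⇒≤; ≰⇒>; +-mono-≤; +-suc; +-comm;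
         +-commutativeSemigroup; m≤n+o⇒m∸n≤o)
open import Algebra.Properties.CommutativeSemigroup +-commutativeSemigroup using (interchange)
open import Data.Bool using (Bool; true; false; not; _∧_; _∨_)
open import Data.Fin using (Fin; zero; suc; _≟_)
open import Data.Fin.Properties using () renaming (suc-injective to Fin-suc-injective)
open import Data.Fin.Subset using (Subset; ⁅_⁆; ⊥; _∪_; ∣_∣)
open import Data.Fin.Subset.Properties using (x∈⁅x⁆; x∈⁅y⁆⇒x≡y)
open import Data.Vec using ([]; _∷_; lookup)
open import Data.Vec.Properties
  using (lookup-zipWith; lookup∘tabulate; lookup-replicate; []=⇒lookup; lookup⇒[]=)
open import Data.List using (List; []; _∷_; length)
open import Data.Product using (∃; _×_; _,_; proj₁; proj₂)
open import Data.Sum using (_⊎_; inj₁; inj₂)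
open import Data.Empty using (⊥-elim)
open import Function using (_∘_)
open import Relation.Nullary using (yes; no)
open import Relation.Binary.PropositionalEquality
  using (_≡_; _≢_; refl; trans; cong; cong₂; subst)
  renaming (sym to ≡-sym)

∨-introˡ : ∀ {a} b → a ≡ true → a ∨ b ≡ true
∨-introˡ b refl = refl

∨-introʳ : ∀ a {b} → b ≡ true → a ∨ b ≡ true
∨-introʳ true  _ = refl
∨-introʳ false e = e

∨-elim : ∀ a b → a ∨ b ≡ true → a ≡ true ⊎ b ≡ true
∨-elim true  _ _ = inj₁ refl
∨-elim false _ e = inj₂ e

∧-elim : ∀ a b → a ∧ b ≡ true → a ≡ true × b ≡ true
∧-elim true true _ = refl , refl

contrapositive : ∀ {a b : Bool} → (a ≡ true → b ≡ true) → b ≡ false → a ≡ false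
contrapositive {false} _ _ = refl
contrapositive {true}  h e with trans (≡-sym (h refl)) e
... | ()

not-true : ∀ {a} → not a ≡ true → a ≡ false
not-true {false} _ = refl

not-false : ∀ {a} → a ≡ false → not a ≡ true
not-false refl = refl

bit : Bool → ℕ
bit true  = 1
bit false = 0

count : ∀ {n} → (Fin n → Bool) → ℕ
count {zero}  p = 0
count {suc n} p = bit (p zero) + count (p ∘ suc)

_⊆ᵇ_ : ∀ {n} → (Fin n → Bool) → (Fin n → Bool) → Set
p ⊆ᵇ q = ∀ i → p i ≡ true → q i ≡ true

∣S∣≡count : ∀ {n} (S : Subset n) → ∣ S ∣ ≡ count (lookup S)
∣S∣≡count []          = refl
∣S∣≡count (true ∷ S)  = cong suc (∣S∣≡count S)
∣S∣≡count (false ∷ S) = ∣S∣≡count S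

bit-mono : ∀ {a b} → (a ≡ true → b ≡ true) → bit a ≤ bit b
bit-mono {false} _ = z≤n
bit-mono {true}  h rewrite h refl = ≤-refl

count-mono : ∀ {n} {p q : Fin n → Bool} → p ⊆ᵇ q → count p ≤ count q
count-mono {zero}  _ = z≤n
count-mono {suc n} h = +-mono-≤ (bit-mono (h zero)) (count-mono (h ∘ suc))

count-strict : ∀ {n} {p q : Fin n → Bool} → p ⊆ᵇ q →
               ∀ j → p j ≡ false → q j ≡ true → count p < count q
count-strict {suc n} h zero pj qj rewrite pj | qj = s≤s (count-mono (h ∘ suc))
count-strict {suc n} {p} {q} h (suc j) pj qj =
  subst (_≤ count q) (+-suc (bit (p zero)) (count (p ∘ suc)))
    (+-mono-≤ (bit-mono (h zero)) (count-strict (h ∘ suc) j pj qj))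

count-cover : ∀ {n} (p q r : Fin n → Bool) → (∀ i → p i ≡ true → q i ≡ true ⊎ r i ≡ true) →
              count p ≤ count q + count r
count-cover {zero}  _ _ _ _ = z≤n
count-cover {suc n} p q r h =
  subst (bit (p zero) + count (p ∘ suc) ≤_)
    (interchange (bit (q zero)) (bit (r zero)) (count (q ∘ suc)) (count (r ∘ suc)))
    (+-mono-≤ (bit-cover (h zero)) (count-cover (p ∘ suc) (q ∘ suc) (r ∘ suc) (h ∘ suc)))
  where
  bit-cover : ∀ {a b c} → (a ≡ true → b ≡ true ⊎ c ≡ true) → bit a ≤ bit b + bit c
  bit-cover {false}                _ = z≤n
  bit-cover {true} {true}          _ = s≤s z≤n
  bit-cover {true} {false} {true}  _ = ≤-refl
  bit-cover {true} {false} {false} h with h refl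
  ... | inj₁ ()
  ... | inj₂ ()

count-empty : ∀ {n} (p : Fin n → Bool) → (∀ i → p i ≡ false) → count p ≡ 0
count-empty {zero}  _ _ = refl
count-empty {suc n} p h rewrite h zero = count-empty (p ∘ suc) (h ∘ suc)

count-atMostOne : ∀ {n} (p : Fin n → Bool) → (∀ i j → p i ≡ true → p j ≡ true → i ≡ j) →
                  count p ≤ 1
count-atMostOne {zero}  _ _ = z≤n
count-atMostOne {suc n} p h with p zero in p0
... | false = count-atMostOne (p ∘ suc) (λ i j a b → Fin-suc-injective (h (suc i) (suc j) a b))
... | true  = subst (λ c → suc c ≤ 1) (≡-sym (count-empty (p ∘ suc) rest-empty)) ≤-refl
  where
  rest-empty : ∀ i → p (suc i) ≡ false
  rest-empty i with p (suc i) in pi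
  ... | false = refl
  ... | true with h zero (suc i) p0 pi
  ...   | ()

count-complement : ∀ {n} (p : Fin n → Bool) → count p + count (not ∘ p) ≡ n
count-complement {zero}  _ = refl
count-complement {suc n} p with p zero
... | true  = cong suc (count-complement (p ∘ suc))
... | false = trans (+-suc _ _) (cong suc (count-complement (p ∘ suc)))

maximiser : ∀ {m} (f : Fin (suc m) → ℕ) → ∃ λ v → ∀ u → f u ≤ f v
maximiser {zero}  f = zero , λ { zero → ≤-refl }
maximiser {suc m} f with maximiser (f ∘ suc)
... | v , v-max with f zero ≤? f (suc v)
...   | yes le = suc v , λ { zero → le ; (suc u) → v-max u }
...   | no  gt = zero , λ { zero → ≤-refl ; (suc u) → ≤-trans (v-max u) (<⇒≤ (≰⇒> gt)) }

lookup-⊥ : ∀ {n} (i : Fin n) → lookup (⊥ {n = n}) i ≡ false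
lookup-⊥ i = lookup-replicate i false

lookup-⁅x⁆-self : ∀ {n} (x : Fin n) → lookup ⁅ x ⁆ x ≡ true
lookup-⁅x⁆-self x = []=⇒lookup (x∈⁅x⁆ x)

lookup-⁅x⁆ : ∀ {n} (x i : Fin n) → lookup ⁅ x ⁆ i ≡ true → i ≡ x
lookup-⁅x⁆ x i e = x∈⁅y⁆⇒x≡y x (lookup⇒[]= i ⁅ x ⁆ e)

lookup-∪ : ∀ {n} (S T : Subset n) i → lookup (S ∪ T) i ≡ lookup S i ∨ lookup T i
lookup-∪ S T i = lookup-zipWith _∨_ i S T

addAll-grows : ∀ {n} (xs : List (Fin n)) (S : Subset n) → lookup S ⊆ᵇ lookup (addAll xs S)
addAll-grows []       S i e = e
addAll-grows (x ∷ xs) S i e =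
  trans (lookup-∪ ⁅ x ⁆ (addAll xs S) i) (∨-introʳ (lookup ⁅ x ⁆ i) (addAll-grows xs S i e))

addAll-count : ∀ {n} (xs : List (Fin n)) (S : Subset n) →
               count (lookup (addAll xs S)) ≤ length xs + count (lookup S)
addAll-count []       S = ≤-refl
addAll-count (x ∷ xs) S =
  ≤-trans (count-cover _ (lookup ⁅ x ⁆) (lookup (addAll xs S))
             (λ i e → ∨-elim _ _ (trans (≡-sym (lookup-∪ ⁅ x ⁆ (addAll xs S) i)) e)))
          (+-mono-≤ (count-atMostOne (lookup ⁅ x ⁆)
                       (λ i j a b → trans (lookup-⁅x⁆ x i a) (≡-sym (lookup-⁅x⁆ x j b))))
                    (addAll-count xs S))

anyFin-intro : ∀ {n} (p : Fin n → Bool) u → p u ≡ true → anyFin p ≡ true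
anyFin-intro p zero    e = ∨-introˡ _ e
anyFin-intro p (suc u) e = ∨-introʳ (p zero) (anyFin-intro (p ∘ suc) u e)

anyFin-elim : ∀ {n} (p : Fin n → Bool) → anyFin p ≡ true → ∃ λ u → p u ≡ true
anyFin-elim {suc n} p e with ∨-elim (p zero) _ e
... | inj₁ a = zero , a
... | inj₂ b with anyFin-elim (p ∘ suc) b
...   | u , c = suc u , c

module Process {n : ℕ} (D : Fin n → Fin n → Bool) (v : Fin n) (σ : Strategy n) where

  B : ℕ → Fin n → Bool
  B k = lookup (burning D v σ k)

  P : ℕ → Fin n → Bool
  P k = lookup (protected D v σ k)

  step : ∀ k w → B (suc k) w ≡
         B k w ∨ (not (B k w) ∧ not (P (suc k) w) ∧ anyFin (λ u → B k u ∧ D u w))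
  step k w = trans (lookup-zipWith _∨_ w (burning D v σ k) _)
                   (cong (B k w ∨_) (lookup∘tabulate _ w))

  origin-burns : B 0 v ≡ true
  origin-burns = lookup-⁅x⁆-self v

  keeps-burning : ∀ k → B k ⊆ᵇ B (suc k)
  keeps-burning k w e = trans (step k w) (∨-introˡ _ e)

  stays-protected : ∀ k → P k ⊆ᵇ P (suc k)
  stays-protected k = addAll-grows (σ k) (protected D v σ k)

  spreads : ∀ k u w → B k u ≡ true → D u w ≡ true → P (suc k) w ≡ false → B (suc k) w ≡ true
  spreads k u w bu duw pw =
    trans (step k w) (catch (B k w) (P (suc k) w) _ pw
                        (anyFin-intro (λ u → B k u ∧ D u w) u (cong₂ _∧_ bu duw)))
    where
    catch : ∀ a q c → q ≡ false → c ≡ true → a ∨ (not a ∧ not q ∧ c) ≡ true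
    catch true  _     _    _ _ = refl
    catch false false true _ _ = refl

  burn-cause : ∀ k w → B (suc k) w ≡ true →
               B k w ≡ true ⊎ (P (suc k) w ≡ false × ∃ λ u → B k u ≡ true × D u w ≡ true)
  burn-cause k w e with cases (B k w) (P (suc k) w) _ (trans (≡-sym (step k w)) e)
    where
    cases : ∀ a q c → a ∨ (not a ∧ not q ∧ c) ≡ true → a ≡ true ⊎ (q ≡ false × c ≡ true)
    cases true  _     _    _ = inj₁ refl
    cases false false true _ = inj₂ (refl , refl)
  ... | inj₁ a = inj₁ a
  ... | inj₂ (pw , c) with anyFin-elim (λ u → B k u ∧ D u w) c
  ...   | u , d = inj₂ (pw , u , ∧-elim _ _ d)

  stable-persists : ∀ k → B (suc k) ⊆ᵇ B k → B (suc (suc k)) ⊆ᵇ B (suc k)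
  stable-persists k stable w e with burn-cause (suc k) w e
  ... | inj₁ a = a
  ... | inj₂ (pw , u , bu , duw) =
    spreads k u w (stable u bu) duw (contrapositive (stays-protected (suc k) w) pw)

  B2⊆B2+ : ∀ m → B 2 ⊆ᵇ B (2 + m)
  B2⊆B2+ zero    w e = e
  B2⊆B2+ (suc m) w e = keeps-burning (2 + m) w (B2⊆B2+ m w e)

  stopped-contains-B2 : ∀ k → B (suc k) ⊆ᵇ B k → B 2 ⊆ᵇ B k
  stopped-contains-B2 zero          stable w e = stable w (stable-persists 0 stable w e)
  stopped-contains-B2 (suc zero)    stable     = stable
  stopped-contains-B2 (suc (suc m)) _          = B2⊆B2+ m

  protected-count : ∀ f → (∀ k → length (σ k) ≤ f) → ∀ k → count (P k) ≤ k * f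
  protected-count f _ zero =
    subst (_≤ 0) (≡-sym (count-empty (P 0) lookup-⊥)) ≤-refl
  protected-count f bound (suc k) =
    ≤-trans (addAll-count (σ k) (protected D v σ k))
            (+-mono-≤ (bound k) (protected-count f bound k))

record Tournament {n : ℕ} (D : Fin n → Fin n → Bool) : Set where
  field
    loopless : ∀ u → D u u ≡ false
    total    : ∀ u w → u ≢ w → D u w ≡ false → D w u ≡ true

adj-K : ∀ {n} (u w : Fin n) → u ≢ w → adj (K n) u w ≡ true
adj-K zero    zero    ne = ⊥-elim (ne refl)
adj-K zero    (suc w) _  = refl
adj-K (suc u) zero    _  = refl
adj-K (suc u) (suc w) ne = adj-K u w (ne ∘ cong suc)

orientation-of-K : ∀ {n} (D : Fin n → Fin n → Bool) → IsOrientation (K n) D → Tournament D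
orientation-of-K {n} D (along-edges , one-direction) = record { loopless = loopless ; total = total }
  where
  loopless : ∀ u → D u u ≡ false
  loopless u with D u u in e
  ... | false = refl
  ... | true with trans (≡-sym (along-edges u u e)) (irrefl (K n) u)
  ...   | ()
  total : ∀ u w → u ≢ w → D u w ≡ false → D w u ≡ true
  total u w ne e = trans (one-direction w u (adj-K w u (ne ∘ ≡-sym))) (cong not e)

module MaxOutDegreeStart {n : ℕ} (D : Fin n → Fin n → Bool) (tournament : Tournament D)
                         (v : Fin n) (v-max : ∀ u → count (D u) ≤ count (D v))
                         (σ : Strategy n) (valid : ValidStrategy D v 1 σ) where

  open Process D v σ
  open Tournament tournament

  protected-by : ∀ k → count (P k) ≤ k * 1
  protected-by = protected-count 1 (proj₁ ∘ valid)

  escapee : Fin n → Bool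
  escapee w = not (B 2 w) ∧ not (P 2 w)

  escapee-beats-B1 : ∀ w → escapee w ≡ true → B 1 ⊆ᵇ D w
  escapee-beats-B1 w e x bx = total x w x≢w x↛w
    where
    w-unburnt : B 2 w ≡ false
    w-unburnt = not-true (proj₁ (∧-elim _ _ e))
    x↛w : D x w ≡ false
    x↛w = contrapositive (λ d → spreads 1 x w bx d (not-true (proj₂ (∧-elim _ _ e))))
                         w-unburnt
    x≢w : x ≢ w
    x≢w refl with trans (≡-sym (keeps-burning 1 x bx)) w-unburnt
    ... | ()

  unguarded : Fin n → Bool
  unguarded x = D v x ∧ not (P 1 x)

  -- At index 1, at least d⁺(v) vertices burn: v and the unguarded ones.
  outdegree≤B1 : count (D v) ≤ count (B 1)
  outdegree≤B1 = ≤-trans (count-cover (D v) (P 1) unguarded guarded-or-not)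
                         (≤-trans (+-mono-≤ (protected-by 1) ≤-refl) unguarded<B1)
    where
    guarded-or-not : ∀ x → D v x ≡ true → P 1 x ≡ true ⊎ unguarded x ≡ true
    guarded-or-not x dvx with P 1 x
    ... | true  = inj₁ refl
    ... | false rewrite dvx = inj₂ refl
    unguarded⊆B1 : unguarded ⊆ᵇ B 1
    unguarded⊆B1 x e with ∧-elim _ _ e
    ... | dvx , px = spreads 0 v x origin-burns dvx (not-true px)
    v-guarded : unguarded v ≡ false
    v-guarded rewrite loopless v = refl
    unguarded<B1 : count unguarded < count (B 1)
    unguarded<B1 = count-strict unguarded⊆B1 v v-guarded (keeps-burning 0 v origin-burns)

  -- No escapee beats another: it would have out-degree above d⁺(v).
  escapees-independent : ∀ w₁ w₂ → escapee w₁ ≡ true → escapee w₂ ≡ true → D w₁ w₂ ≡ false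
  escapees-independent w₁ w₂ e₁ e₂ with D w₁ w₂ in beats
  ... | false = refl
  ... | true  = ⊥-elim (<-irrefl refl (≤-trans B1<outdegree (≤-trans (v-max w₁) outdegree≤B1)))
    where
    w₂-outside : B 1 w₂ ≡ false
    w₂-outside = contrapositive (keeps-burning 1 w₂) (not-true (proj₁ (∧-elim _ _ e₂)))
    B1<outdegree : count (B 1) < count (D w₁)
    B1<outdegree = count-strict (escapee-beats-B1 w₁ e₁) w₂ w₂-outside beats

  -- Two distinct escapees would be joined by an arc in one direction.
  at-most-one-escapee : count escapee ≤ 1
  at-most-one-escapee = count-atMostOne escapee same
    where
    same : ∀ i j → escapee i ≡ true → escapee j ≡ true → i ≡ j
    same i j eᵢ eⱼ with i ≟ j
    ... | yes i≡j = i≡j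
    ... | no  i≢j with trans (≡-sym (total i j i≢j (escapees-independent i j eᵢ eⱼ)))
                             (escapees-independent j i eⱼ eᵢ)
    ...   | ()

  -- Outside B 2 there are only the escapee and the (at most two) protected.
  unburnt-at-2 : count (not ∘ B 2) ≤ 3
  unburnt-at-2 = ≤-trans (count-cover (not ∘ B 2) escapee (P 2) escapes-or-protected)
                         (+-mono-≤ at-most-one-escapee (protected-by 2))
    where
    escapes-or-protected : ∀ x → not (B 2 x) ≡ true → escapee x ≡ true ⊎ P 2 x ≡ true
    escapes-or-protected x nb with P 2 x
    ... | true  = inj₂ refl
    ... | false rewrite nb = inj₁ refl

  burnt-at-least : ∀ k → burning D v σ (suc k) ≡ burning D v σ k → n ∸ 3 ≤ ∣ burning D v σ k ∣
  burnt-at-least k stopped =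
    subst (n ∸ 3 ≤_) (≡-sym (∣S∣≡count (burning D v σ k))) (m≤n+o⇒m∸n≤o n 3 n≤3+burnt)
    where
    stable : B (suc k) ⊆ᵇ B k
    stable w e = trans (cong (λ S → lookup S w) (≡-sym stopped)) e
    unburnt : count (not ∘ B k) ≤ 3
    unburnt = ≤-trans (count-mono (λ w e →
                not-false (contrapositive (stopped-contains-B2 k stable w) (not-true e))))
                unburnt-at-2
    n≤3+burnt : n ≤ 3 + count (B k)
    n≤3+burnt = subst (_≤ 3 + count (B k))
                  (trans (+-comm (count (not ∘ B k)) (count (B k))) (count-complement (B k)))
                  (+-mono-≤ unburnt ≤-refl)

-- Start the fire at a vertex of maximum out-degree.
proposition3p2 : ∀ (n : ℕ) → 1 ≤ n → βArrow≥ (K n) 1 (n ∸ 3)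
proposition3p2 (suc m) _ D isOrientation with maximiser (count ∘ D)
... | v , v-max = v , λ σ valid →
  MaxOutDegreeStart.burnt-at-least D (orientation-of-K D isOrientation) v v-max σ valid
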